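{- Let $(L,\leq)$ be a finite lattice. Then the lattice of weak factorization systems on $L$ is a trim lattice.
   Context: A finite lattice $(L,\leq)$ is viewed as a category with a unique morphism $a\to b$ whenever $a\leq b$. A relation $(a,b)$ lifts on the left $(c,d)$ if whenever $a\leq c$ and $b\leq d$ we have $b\leq c$. A weak factorization system on $L$ is a pair $(\mathcal{L},\mathcal{R})$ of sets of relations such that every relation $a\leq b$ factors as $a\leq x\leq b$ with $(a,x)\in\mathcal{L}$, $(x,b)\in\mathcal{R}$, $\mathcal{L}$ is exactly the set of relations lifting on the left every relation of $\mathcal{R}$, and $\mathcal{R}$ is exactly the set of relations lifted on the left by every relation of $\mathcal{L}$; ordered by inclusion of right classes. A lattice is trim if it has a maximal chain of $n+1$ left modular elements, exactly $n$ join-irreducibles and exactly $n$ meet-irreducibles; $x$ is left modular if $(y\vee x)\wedge z=y\vee(x\wedge z)$ for all $y<z$. -}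

module Defs where

open import Level using (Level; _⊔_) renaming (zero to 0ℓ)
open import Data.Nat using (ℕ; suc)
open import Data.Fin using (Fin) renaming (_<_ to _<ᶠ_)
open import Data.Bool using (Bool; T)
open import Data.Product using (Σ; ∃; _×_; _,_)
open import Data.Sum using (_⊎_)
open import Relation.Nullary using (¬_)
open import Relation.Binary.PropositionalEquality using (_≡_)
open import Relation.Binary.Core using (Rel)

-- Generic order-theoretic notions for a preordered type (P, ⊑);
-- equality of elements is ≈ (mutual ⊑), i.e. we work in the
-- associated poset.

module OrderNotions {a b : Level} {P : Set a} (_⊑_ : P → P → Set b) where

  _≈_ : P → P → Set b
  x ≈ y = (x ⊑ y) × (y ⊑ x)

  _⊏_ : P → P → Set b
  x ⊏ y = (x ⊑ y) × ¬ (y ⊑ x)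

  IsJoinOf : P → P → P → Set (a ⊔ b)
  IsJoinOf x y z = (x ⊑ z) × (y ⊑ z) × (∀ w → x ⊑ w → y ⊑ w → z ⊑ w)

  IsMeetOf : P → P → P → Set (a ⊔ b)
  IsMeetOf x y z = (z ⊑ x) × (z ⊑ y) × (∀ w → w ⊑ x → w ⊑ y → w ⊑ z)

  JoinIrreducible : P → Set (a ⊔ b)
  JoinIrreducible j =
    ¬ (∀ y → j ⊑ y) × (∀ y z → IsJoinOf y z j → (j ≈ y) ⊎ (j ≈ z))

  MeetIrreducible : P → Set (a ⊔ b)
  MeetIrreducible m =
    ¬ (∀ y → y ⊑ m) × (∀ y z → IsMeetOf y z m → (m ≈ y) ⊎ (m ≈ z))

  LeftModular : (P → P → P) → (P → P → P) → P → Set (a ⊔ b)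
  LeftModular _∨_ _∧_ x = ∀ y z → y ⊏ z → ((y ∨ x) ∧ z) ≈ (y ∨ (x ∧ z))

  ExactlyN : ℕ → (P → Set (a ⊔ b)) → Set (a ⊔ b)
  ExactlyN n Q = Σ (Fin n → P) λ e →
      (∀ i j → e i ≈ e j → i ≡ j)
    × (∀ i → Q (e i))
    × (∀ x → Q x → ∃ λ i → x ≈ e i)

  record IsTrim : Set (a ⊔ b) where
    field
      ⊑-refl  : ∀ x → x ⊑ x
      ⊑-trans : ∀ x y z → x ⊑ y → y ⊑ z → x ⊑ z
      finite  : ∃ λ k → Σ (Fin k → P) λ e → ∀ x → ∃ λ i → x ≈ e i
      _∨_ _∧_ : P → P → P
      isJoin  : ∀ x y → IsJoinOf x y (x ∨ y)
      isMeet  : ∀ x y → IsMeetOf x y (x ∧ y)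
      n       : ℕ
      chain         : Fin (suc n) → P
      chain-strict  : ∀ i j → i <ᶠ j → chain i ⊏ chain j
      chain-maximal : ∀ x → (∀ i → (x ⊑ chain i) ⊎ (chain i ⊑ x)) → ∃ λ i → x ≈ chain i
      chain-leftModular : ∀ i → LeftModular _∨_ _∧_ (chain i)
      joinIrreducibles : ExactlyN n JoinIrreducible
      meetIrreducibles : ExactlyN n MeetIrreducible

-- A set of relations is given by its (Bool-valued)
-- characteristic function on pairs (a , b); members must satisfy a ≤ b.

module WFSNotions {ℓ : Level} (m : ℕ) (_≤_ : Rel (Fin m) ℓ) where

  -- (a,b) lifts on the left (c,d)
  Lifts : Fin m → Fin m → Fin m → Fin m → Set ℓ
  Lifts a b c d = a ≤ c → b ≤ d → b ≤ c

  RelSet : Set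
  RelSet = Fin m → Fin m → Bool

  record WFS : Set ℓ where
    field
      𝓛 𝓡   : RelSet
      𝓛-rel : ∀ a b → T (𝓛 a b) → a ≤ b
      𝓡-rel : ∀ a b → T (𝓡 a b) → a ≤ b
      factor : ∀ a b → a ≤ b →
        ∃ λ x → (a ≤ x) × (x ≤ b) × T (𝓛 a x) × T (𝓡 x b)
      𝓛-char : ∀ a b → a ≤ b →
        (T (𝓛 a b) → ∀ c d → T (𝓡 c d) → Lifts a b c d)
        × ((∀ c d → T (𝓡 c d) → Lifts a b c d) → T (𝓛 a b))
      𝓡-char : ∀ c d → c ≤ d →
        (T (𝓡 c d) → ∀ a b → T (𝓛 a b) → Lifts a b c d)
        × ((∀ a b → T (𝓛 a b) → Lifts a b c d) → T (𝓡 c d))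

  open WFS public

  _⊑_ : WFS → WFS → Set
  W ⊑ W' = ∀ a b → T (𝓡 W a b) → T (𝓡 W' a b)

-- A weak factorization system on L is determined by its right class, and the
-- right classes are exactly the transfer systems: reflexive, transitive
-- subrelations of ≤ closed under restriction (a → b and z ≤ b give a ∧ z → z).
-- A right lifting class is always one, and a transfer system S equals
-- rlp (llp S) because c ≤ d factors through the least x ≥ c with x → d in S.
--
-- Fix a linear extension of the order on the n pairs a < b given by
-- (a′ , b′) ≺ (a , b) iff a′ < a, or a′ = a and b′ < b. A composite a → c of
-- a → b → c is ≺-below b → c, and a restriction of a → b is an identity or
-- ≺-below a → b, so the identities together with the first k pairs form a
-- transfer system, chain k. Consecutive members of this chain differ by a single
-- relation, hence it is maximal, and chain k is left modular: the join of y with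
-- chain k consists of the composites a → u → b with a → u in chain k and u → b
-- in y.
--
-- The transfer system generated by one pair x < y consists of the identities and
-- the restrictions x ∧ b → b, b ≤ y; without x → y it is still a transfer system,
-- its unique lower cover. Every transfer system is the join of those generated by
-- its pairs, so these n are all the join-irreducibles. Exchanging left and right
-- classes turns weak factorization systems on L into those on the dual lattice,
-- reversing their order, so the join-irreducibles for the dual give n
-- meet-irreducibles.

module Submission where

open import Defs
open import Level using (Level)
open import Algebra.Core using (Op₂)
open import Data.Bool using (false; T) renaming (_∨_ to _or_; _∧_ to _and_)
open import Data.Bool.Properties using (T-∨; T-∧; T-≡)
open import Data.Fin using (Fin; zero; suc; toℕ; fromℕ<; _≟_; finToFun; funToFin)
open import Data.Fin.Properties
  using (all?; any?; 2↔Bool; finToFun-funToFin; toℕ-injective; toℕ<n; toℕ-fromℕ<)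
import Data.Fin.Subset as Subset
open import Data.Fin.Subset.Properties using (p⊂q⇒∣p∣<∣q∣)
open import Data.List using (List; []; _∷_; allFin; filter; lookup; length; cartesianProduct)
open import Data.List.Membership.Propositional using (_∈_)
open import Data.List.Membership.Propositional.Properties
  using (∈-allFin; ∈-filter⁺; ∈-filter⁻; ∈-lookup; ∈-cartesianProduct⁺)
open import Data.List.Relation.Binary.Permutation.Propositional using (↭-sym; ↭⇒↭ₛ)
open import Data.List.Relation.Binary.Permutation.Propositional.Properties using (∈-resp-↭)
import Data.List.Relation.Binary.Permutation.Setoid.Properties as Permutationₛ
import Data.List.Relation.Unary.All as All
open import Data.List.Relation.Unary.AllPairs using (_∷_)
open import Data.List.Relation.Unary.Any using (here; there; index)
open import Data.List.Relation.Unary.Any.Properties using (lookup-index)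
import Data.List.Relation.Unary.Sorted.TotalOrder.Properties as Sorted
open import Data.List.Relation.Unary.Unique.Propositional using (Unique)
import Data.List.Relation.Unary.Unique.Propositional.Properties as Unique
import Data.List.Sort as Sort
open import Data.Nat as ℕ using (ℕ; zero; suc; _^_)
import Data.Nat.Properties as ℕ
open import Data.Product using (Σ; ∃; _×_; _,_; proj₁; proj₂; swap)
open import Data.Product.Properties using (≡-dec)
open import Data.Product.Relation.Binary.Lex.NonStrict using (×-decTotalOrder)
open import Data.Sum as Sum using (_⊎_; inj₁; inj₂; [_,_])
open import Data.Vec using (tabulate)
open import Data.Vec.Properties using (lookup∘tabulate; lookup⇒[]=; []=⇒lookup)
open import Function using (Equivalence; Inverse; _∘_; flip)
open import Relation.Binary.Bundles using (DecTotalOrder)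
open import Relation.Binary.Core using (Rel)
import Relation.Binary.Construct.On as On
open import Relation.Binary.Lattice.Bundles using (Lattice)
open import Relation.Binary.Lattice.Properties.Lattice using (∧-∨-isLattice)
import Relation.Binary.Lattice.Properties.MeetSemilattice as MeetSemilatticeProperties
open import Relation.Binary.Lattice.Structures using (IsLattice)
open import Relation.Binary.PropositionalEquality
  using (_≡_; refl; sym; trans; cong; cong₂; subst; setoid; module ≡-Reasoning)
open import Relation.Nullary using (¬_; Dec; yes; no; contradiction)
open import Relation.Nullary.Decidable
  using (isYes; toWitness; fromWitness; _×-dec_; _⊎-dec_; _→-dec_; ¬?; T?)

lookup-injective : ∀ {a} {A : Set a} {xs : List A} → Unique xs →
                   ∀ i j → lookup xs i ≡ lookup xs j → i ≡ j
lookup-injective {xs = _ ∷ _} _               zero    zero    _  = refl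
lookup-injective {xs = _ ∷ _} (x∉xs ∷ _)      zero    (suc j) x≡ =
  contradiction x≡ (All.lookup x∉xs (∈-lookup j))
lookup-injective {xs = _ ∷ _} (x∉xs ∷ _)      (suc i) zero    ≡x =
  contradiction (sym ≡x) (All.lookup x∉xs (∈-lookup i))
lookup-injective {xs = _ ∷ _} (_ ∷ xs-unique) (suc i) (suc j) eq =
  cong suc (lookup-injective xs-unique i j eq)

module FiniteJoins
  {a b : Level} {P : Set a} (_⊑_ : P → P → Set b) (⊑-trans : ∀ {x y z} → x ⊑ y → y ⊑ z → x ⊑ z)
  (_⋎_ : P → P → P) (⋎-isJoin : ∀ x y → OrderNotions.IsJoinOf _⊑_ x y (x ⋎ y))
  (⊥ : P) (⊥-least : ∀ x → ⊥ ⊑ x)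
  where

  open OrderNotions _⊑_

  ⋁ : {I : Set} → (I → P) → List I → P
  ⋁ e []       = ⊥
  ⋁ e (i ∷ is) = e i ⋎ ⋁ e is

  ⊑-⋁ : ∀ {I : Set} (e : I → P) {i is} → i ∈ is → e i ⊑ ⋁ e is
  ⊑-⋁ e {is = j ∷ is} (here refl) = proj₁ (⋎-isJoin (e j) (⋁ e is))
  ⊑-⋁ e {is = j ∷ is} (there i∈is) = ⊑-trans (⊑-⋁ e i∈is) (proj₁ (proj₂ (⋎-isJoin (e j) (⋁ e is))))

  ⋁-least : ∀ {I : Set} (e : I → P) is {w} → (∀ i → i ∈ is → e i ⊑ w) → ⋁ e is ⊑ w
  ⋁-least e []       {w} _   = ⊥-least w
  ⋁-least e (i ∷ is) {w} e⊑w =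
    proj₂ (proj₂ (⋎-isJoin (e i) (⋁ e is))) w (e⊑w i (here refl))
                                             (⋁-least e is λ j j∈is → e⊑w j (there j∈is))

  joinIrreducible-⋁ : ∀ {I : Set} (e : I → P) is {j} → JoinIrreducible j → j ≈ ⋁ e is → ∃ λ i → j ≈ e i
  joinIrreducible-⋁ e []       (notBottom , _) (j⊑⊥ , _) =
    contradiction (λ y → ⊑-trans j⊑⊥ (⊥-least y)) notBottom
  joinIrreducible-⋁ e (i ∷ is) {j} ji@(_ , irreducible) (j⊑⋁ , ⋁⊑j)
    with irreducible (e i) (⋁ e is)
           ( ⊑-trans (proj₁ isJoin) ⋁⊑j
           , ⊑-trans (proj₁ (proj₂ isJoin)) ⋁⊑j
           , λ w ei⊑w ⋁is⊑w → ⊑-trans j⊑⋁ (proj₂ (proj₂ isJoin) w ei⊑w ⋁is⊑w))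
    where
      isJoin : IsJoinOf (e i) (⋁ e is) (e i ⋎ ⋁ e is)
      isJoin = ⋎-isJoin (e i) (⋁ e is)
  ... | inj₁ j≈ei  = i , j≈ei
  ... | inj₂ j≈⋁is = joinIrreducible-⋁ e is ji j≈⋁is

module _ {a b : Level} {P : Set a} (_⊑_ : P → P → Set b) (⊑-trans : ∀ {x y z} → x ⊑ y → y ⊑ z → x ⊑ z)
         (_⋎_ _⋏_ : P → P → P)
         (⋎-isJoin : ∀ x y → OrderNotions.IsJoinOf _⊑_ x y (x ⋎ y))
         (⋏-isMeet : ∀ x y → OrderNotions.IsMeetOf _⊑_ x y (x ⋏ y)) where

  modular-inequality : ∀ {x y z} → y ⊑ z → (y ⋎ (x ⋏ z)) ⊑ ((y ⋎ x) ⋏ z)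
  modular-inequality {x} {y} {z} y⊑z =
    let y⊑y⋎x , x⊑y⋎x , _ = ⋎-isJoin y x
        x⋏z⊑x , x⋏z⊑z , _ = ⋏-isMeet x z
        _ , _ , ⋏-greatest = ⋏-isMeet (y ⋎ x) z
        _ , _ , ⋎-least = ⋎-isJoin y (x ⋏ z)
    in ⋎-least ((y ⋎ x) ⋏ z) (⋏-greatest y y⊑y⋎x y⊑z)
                             (⋏-greatest (x ⋏ z) (⊑-trans x⋏z⊑x x⊑y⋎x) x⋏z⊑z)

module AntitoneEquivalence
  {a b c d : Level} {P : Set a} {Q : Set c} (_⊑_ : P → P → Set b) (_⊑′_ : Q → Q → Set d)
  (⊑-trans : ∀ {x y z} → x ⊑ y → y ⊑ z → x ⊑ z) (⊑′-trans : ∀ {u v w} → u ⊑′ v → v ⊑′ w → u ⊑′ w)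
  (f : P → Q) (g : Q → P)
  (f-antitone : ∀ {x y} → x ⊑ y → f y ⊑′ f x) (g-antitone : ∀ {u v} → u ⊑′ v → g v ⊑ g u)
  (x⊑gfx : ∀ x → x ⊑ g (f x)) (gfx⊑x : ∀ x → g (f x) ⊑ x)
  (u⊑′fgu : ∀ u → u ⊑′ f (g u)) (fgu⊑′u : ∀ u → f (g u) ⊑′ u)
  where

  open OrderNotions _⊑_
  open OrderNotions _⊑′_ using () renaming
    (_≈_ to _≈′_; JoinIrreducible to JoinIrreducible′; ExactlyN to ExactlyN′)

  f-reflects : ∀ {x y} → f y ⊑′ f x → x ⊑ y
  f-reflects {x} {y} fy⊑fx = ⊑-trans (x⊑gfx x) (⊑-trans (g-antitone fy⊑fx) (gfx⊑x y))

  g-reflects : ∀ {u v} → g v ⊑ g u → u ⊑′ v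
  g-reflects {u} {v} gv⊑gu = ⊑′-trans (u⊑′fgu u) (⊑′-trans (f-antitone gv⊑gu) (fgu⊑′u v))

  joinIrreducible⇒meetIrreducible : ∀ {u} → JoinIrreducible′ u → MeetIrreducible (g u)
  joinIrreducible⇒meetIrreducible {u} (notBottom , irreducible) =
      (λ top → notBottom λ v → g-reflects (top (g v)))
    , λ y z (gu⊑y , gu⊑z , greatest) →
        Sum.map (≈-from y gu⊑y) (≈-from z gu⊑z)
          (irreducible (f y) (f z)
            ( ⊑′-trans (f-antitone gu⊑y) (fgu⊑′u u)
            , ⊑′-trans (f-antitone gu⊑z) (fgu⊑′u u)
            , λ w fy⊑w fz⊑w → g-reflects (greatest (g w)
                (⊑-trans (g-antitone fy⊑w) (gfx⊑x y))
                (⊑-trans (g-antitone fz⊑w) (gfx⊑x z)))))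
    where
      ≈-from : ∀ y → g u ⊑ y → u ≈′ f y → g u ≈ y
      ≈-from y gu⊑y (u⊑fy , _) = gu⊑y , ⊑-trans (x⊑gfx y) (g-antitone u⊑fy)

  meetIrreducible⇒joinIrreducible : ∀ {x} → MeetIrreducible x → JoinIrreducible′ (f x)
  meetIrreducible⇒joinIrreducible {x} (notTop , irreducible) =
      (λ bottom → notTop λ y → f-reflects (bottom (f y)))
    , λ v w (v⊑fx , w⊑fx , least) →
        Sum.map (≈-from v v⊑fx) (≈-from w w⊑fx)
          (irreducible (g v) (g w)
            ( ⊑-trans (x⊑gfx x) (g-antitone v⊑fx)
            , ⊑-trans (x⊑gfx x) (g-antitone w⊑fx)
            , λ y y⊑gv y⊑gw → f-reflects (least (f y)
                (⊑′-trans (u⊑′fgu v) (f-antitone y⊑gv))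
                (⊑′-trans (u⊑′fgu w) (f-antitone y⊑gw)))))
    where
      ≈-from : ∀ v → v ⊑′ f x → x ≈ g v → f x ≈′ v
      ≈-from v v⊑fx (_ , gv⊑x) = ⊑′-trans (f-antitone gv⊑x) (fgu⊑′u v) , v⊑fx

  exactlyN-meetIrreducible : ∀ {n} → ExactlyN′ n JoinIrreducible′ → ExactlyN n MeetIrreducible
  exactlyN-meetIrreducible (e , e-injective , e-irreducible , e-complete) =
      g ∘ e
    , (λ i j (gei⊑gej , gej⊑gei) → e-injective i j (g-reflects gej⊑gei , g-reflects gei⊑gej))
    , (λ i → joinIrreducible⇒meetIrreducible (e-irreducible i))
    , λ x mi → let i , (fx⊑ei , ei⊑fx) = e-complete (f x) (meetIrreducible⇒joinIrreducible mi) in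
        i , (⊑-trans (x⊑gfx x) (g-antitone ei⊑fx) , f-reflects (⊑′-trans fx⊑ei (u⊑′fgu (e i))))

module Duality {ℓ : Level} (m : ℕ) (_≤_ : Rel (Fin m) ℓ) where

  open WFSNotions m _≤_
  private
    module Op = WFSNotions m (flip _≤_)

  dual : WFS → Op.WFS
  dual W = record
    { 𝓛      = flip (𝓡 W)
    ; 𝓡      = flip (𝓛 W)
    ; 𝓛-rel  = λ a b → 𝓡-rel W b a
    ; 𝓡-rel  = λ a b → 𝓛-rel W b a
    ; factor = λ a b b≤a → let x , b≤x , x≤a , l , r = factor W b a b≤a in x , x≤a , b≤x , r , l
    ; 𝓛-char = λ a b b≤a → let to , from = 𝓡-char W b a b≤a in
        (λ r c d l c≤a d≤b → to r d c l d≤b c≤a) ,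
        (λ lifts → from λ d c l d≤b c≤a → lifts c d l c≤a d≤b)
    ; 𝓡-char = λ c d d≤c → let to , from = 𝓛-char W d c d≤c in
        (λ l a b r c≤a d≤b → to l b a r d≤b c≤a) ,
        (λ lifts → from λ b a r d≤b c≤a → lifts a b r c≤a d≤b)
    }

  dual-antitone : ∀ {W W′} → W ⊑ W′ → dual W′ Op.⊑ dual W
  dual-antitone {W} {W′} W⊑W′ a b l′ =
    let b≤a = 𝓛-rel W′ b a l′ in
    proj₂ (𝓛-char W b a b≤a) λ c d r → proj₁ (𝓛-char W′ b a b≤a) l′ c d (W⊑W′ c d r)

module WeakFactorizationSystems {ℓ : Level} (m : ℕ) (_≤_ : Rel (Fin m) ℓ) (_∨_ _∧_ : Op₂ (Fin m))
                                (isLattice : IsLattice _≡_ _≤_ _∨_ _∧_) where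

  open WFSNotions m _≤_ public
  open OrderNotions _⊑_ public renaming (_≈_ to _≋_)
  open IsLattice isLattice public
    using (x∧y≤x; x∧y≤y; ∧-greatest)
    renaming (refl to ≤-refl; trans to ≤-trans; antisym to ≤-antisym)

  lattice : Lattice _ _ _
  lattice = record { isLattice = isLattice }

  isLatticeᵒᵖ : IsLattice _≡_ (flip _≤_) _∧_ _∨_
  isLatticeᵒᵖ = ∧-∨-isLattice lattice
  open MeetSemilatticeProperties (Lattice.meetSemilattice lattice) public
    using (y≤x⇒x∧y≈y; ∧-comm; ∧-assoc; ≈-dec⇒≤-dec)

  _≤?_ : ∀ a b → Dec (a ≤ b)
  _≤?_ = ≈-dec⇒≤-dec _≟_

  x≤y⇒x∧y≡x : ∀ {x y} → x ≤ y → x ∧ y ≡ x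
  x≤y⇒x∧y≡x {x} {y} x≤y = trans (∧-comm x y) (y≤x⇒x∧y≈y x≤y)

  _<_ : Rel (Fin m) ℓ
  a < b = a ≤ b × ¬ a ≡ b

  _<?_ : ∀ a b → Dec (a < b)
  a <? b = (a ≤? b) ×-dec ¬? (a ≟ b)

  IsStrict : Fin m × Fin m → Set ℓ
  IsStrict (a , b) = a < b

  isStrict? : ∀ p → Dec (IsStrict p)
  isStrict? (a , b) = a <? b

  _⊆_ : RelSet → RelSet → Set
  S ⊆ S′ = ∀ a b → T (S a b) → T (S′ a b)

  AreRelations : RelSet → Set ℓ
  AreRelations S = ∀ a b → T (S a b) → a ≤ b

  ⟦_⟧ : {p : Level} {P : Fin m → Fin m → Set p} → (∀ a b → Dec (P a b)) → RelSet
  ⟦ P? ⟧ a b = isYes (P? a b)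

  _∪_ _∩_ : RelSet → RelSet → RelSet
  (S ∪ S′) a b = S a b or S′ a b
  (S ∩ S′) a b = S a b and S′ a b

  ∅ : RelSet
  ∅ _ _ = false

  LeftLifting : RelSet → Fin m → Fin m → Set ℓ
  LeftLifting K a b = a ≤ b × (∀ c d → T (K c d) → c ≤ d → Lifts a b c d)

  RightLifting : RelSet → Fin m → Fin m → Set ℓ
  RightLifting K c d = c ≤ d × (∀ a b → T (K a b) → a ≤ b → Lifts a b c d)

  lifts? : ∀ a b c d → Dec (Lifts a b c d)
  lifts? a b c d = (a ≤? c) →-dec ((b ≤? d) →-dec (b ≤? c))

  opaque
    llp rlp : RelSet → RelSet
    llp K = ⟦ (λ a b → (a ≤? b) ×-dec all? λ c → all? λ d →
                         T? (K c d) →-dec ((c ≤? d) →-dec lifts? a b c d)) ⟧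
    rlp K = ⟦ (λ c d → (c ≤? d) ×-dec all? λ a → all? λ b →
                         T? (K a b) →-dec ((a ≤? b) →-dec lifts? a b c d)) ⟧

    llp⁻ : ∀ {K a b} → T (llp K a b) → LeftLifting K a b
    llp⁻ = toWitness
    llp⁺ : ∀ {K a b} → LeftLifting K a b → T (llp K a b)
    llp⁺ = fromWitness
    rlp⁻ : ∀ {K a b} → T (rlp K a b) → RightLifting K a b
    rlp⁻ = toWitness
    rlp⁺ : ∀ {K a b} → RightLifting K a b → T (rlp K a b)
    rlp⁺ = fromWitness

  llp-antitone : ∀ {K K′} → K ⊆ K′ → llp K′ ⊆ llp K
  llp-antitone K⊆K′ a b l =
    let a≤b , lifts = llp⁻ l in llp⁺ (a≤b , λ c d k → lifts c d (K⊆K′ c d k))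

  rlp-antitone : ∀ {K K′} → K ⊆ K′ → rlp K′ ⊆ rlp K
  rlp-antitone K⊆K′ c d r =
    let c≤d , lifts = rlp⁻ r in rlp⁺ (c≤d , λ a b k → lifts a b (K⊆K′ a b k))

  ⊆-rlp-llp : ∀ {K} → AreRelations K → K ⊆ rlp (llp K)
  ⊆-rlp-llp rel a b k = rlp⁺ (rel a b k , λ c d l _ → proj₂ (llp⁻ l) a b k (rel a b k))

  record IsTransferSystem (S : RelSet) : Set ℓ where
    field
      relations  : AreRelations S
      reflexive  : ∀ a → T (S a a)
      transitive : ∀ {a b c} → T (S a b) → T (S b c) → T (S a c)
      restrict   : ∀ {a b} z → T (S a b) → z ≤ b → T (S (a ∧ z) z)

  isTransferSystem-⟦_⟧ : ∀ {p} {R : Fin m → Fin m → Set p} (R? : ∀ a b → Dec (R a b)) →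
    (∀ {a b} → R a b → a ≤ b) → (∀ a → R a a) → (∀ {a b c} → R a b → R b c → R a c) →
    (∀ {a b} z → R a b → z ≤ b → R (a ∧ z) z) → IsTransferSystem ⟦ R? ⟧
  isTransferSystem-⟦ R? ⟧ relation reflexive transitive restrict = record
    { relations  = λ a b r → relation (toWitness {a? = R? a b} r)
    ; reflexive  = λ a → fromWitness (reflexive a)
    ; transitive = λ {a} {b} {c} r s →
        fromWitness (transitive (toWitness {a? = R? a b} r) (toWitness {a? = R? b c} s))
    ; restrict   = λ {a} {b} z r z≤b → fromWitness (restrict z (toWitness {a? = R? a b} r) z≤b)
    }

  module _ {p : Level} (Q : Fin m → Set p) (Q? : ∀ x → Dec (Q x))
           (Q-∧ : ∀ {x y} → Q x → Q y → Q (x ∧ y)) where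

    private
      leastAmong : ∀ {q} → Q q → (xs : List (Fin m)) →
                   ∃ λ x → Q x × (∀ y → y ∈ xs → Q y → x ≤ y)
      leastAmong {q} Qq [] = q , Qq , λ _ ()
      leastAmong Qq (y ∷ ys) with leastAmong Qq ys | Q? y
      ... | x , Qx , x≤ | yes Qy = x ∧ y , Q-∧ Qx Qy , λ where
        _ (here refl) _   → x∧y≤y x y
        z (there z∈ys) Qz → ≤-trans (x∧y≤x x y) (x≤ z z∈ys Qz)
      ... | x , Qx , x≤ | no ¬Qy = x , Qx , λ where
        _ (here refl) Qy  → contradiction Qy ¬Qy
        z (there z∈ys) Qz → x≤ z z∈ys Qz

    least : ∀ {q} → Q q → ∃ λ x → Q x × (∀ y → Q y → x ≤ y)
    least Qq = let x , Qx , x≤ = leastAmong Qq (allFin m) in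
      x , Qx , λ y → x≤ y (∈-allFin y)

  module TransferSystem {S : RelSet} (ts : IsTransferSystem S) where
    open IsTransferSystem ts

    factorize : ∀ {c d} → c ≤ d → ∃ λ x → T (llp S c x) × T (S x d)
    factorize {c} {d} c≤d =
      let x , (c≤x , x↝d) , x-least =
            least (λ x → c ≤ x × T (S x d)) (λ x → (c ≤? x) ×-dec T? (S x d))
                  (λ {x} {y} (c≤x , x↝d) (c≤y , y↝d) →
                     ∧-greatest c≤x c≤y , transitive (restrict y x↝d (relations y d y↝d)) y↝d)
                  (c≤d , reflexive d)
      in x , llp⁺ (c≤x , λ c′ d′ c′↝d′ _ c≤c′ x≤d′ →
                    ≤-trans (x-least (c′ ∧ x) (∧-greatest c≤c′ c≤x ,
                                               transitive (restrict x c′↝d′ x≤d′) x↝d))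
                            (x∧y≤x c′ x))
           , x↝d

    rlp-llp-⊆ : rlp (llp S) ⊆ S
    rlp-llp-⊆ c d r =
      let c≤d , lifts = rlp⁻ r
          x , l , x↝d = factorize c≤d
          c≤x , _ = llp⁻ l
          x≤c = lifts c x l c≤x ≤-refl (relations x d x↝d)
      in subst (λ u → T (S u d)) (≤-antisym x≤c c≤x) x↝d

  rlp-isTransferSystem : ∀ K → IsTransferSystem (rlp K)
  rlp-isTransferSystem K = record
    { relations  = λ c d r → proj₁ (rlp⁻ r)
    ; reflexive  = λ a → rlp⁺ (≤-refl , λ _ _ _ _ _ b≤a → b≤a)
    ; transitive = λ r s →
        let a≤b , lifts₁ = rlp⁻ r ; b≤c , lifts₂ = rlp⁻ s in
        rlp⁺ (≤-trans a≤b b≤c , λ x y k x≤y x≤a y≤c →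
                lifts₁ x y k x≤y x≤a (lifts₂ x y k x≤y (≤-trans x≤a a≤b) y≤c))
    ; restrict   = λ {a} {b} z r z≤b →
        let _ , lifts = rlp⁻ r in
        rlp⁺ (x∧y≤y a z , λ x y k x≤y x≤a∧z y≤z →
                ∧-greatest (lifts x y k x≤y (≤-trans x≤a∧z (x∧y≤x a z)) (≤-trans y≤z z≤b)) y≤z)
    }

  isTransferSystem-resp : ∀ {S S′} → S ⊆ S′ → S′ ⊆ S → IsTransferSystem S → IsTransferSystem S′
  isTransferSystem-resp S⊆S′ S′⊆S ts = record
    { relations  = λ a b s → relations a b (S′⊆S a b s)
    ; reflexive  = λ a → S⊆S′ a a (reflexive a)
    ; transitive = λ s t → S⊆S′ _ _ (transitive (S′⊆S _ _ s) (S′⊆S _ _ t))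
    ; restrict   = λ z s z≤b → S⊆S′ _ _ (restrict z (S′⊆S _ _ s) z≤b)
    }
    where open IsTransferSystem ts

  ⊑-refl : ∀ W → W ⊑ W
  ⊑-refl W a b r = r

  ⊑-trans : ∀ {U V W} → U ⊑ V → V ⊑ W → U ⊑ W
  ⊑-trans U⊑V V⊑W a b r = V⊑W a b (U⊑V a b r)

  cofibrantlyGenerated : RelSet → WFS
  cofibrantlyGenerated K = record
    { 𝓛      = llp (rlp K)
    ; 𝓡      = rlp K
    ; 𝓛-rel  = λ a b l → proj₁ (llp⁻ l)
    ; 𝓡-rel  = λ c d r → proj₁ (rlp⁻ r)
    ; factor = λ a b a≤b →
        let x , l , r = TransferSystem.factorize (rlp-isTransferSystem K) a≤b in
        x , proj₁ (llp⁻ l) , proj₁ (rlp⁻ r) , l , r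
    ; 𝓛-char = λ a b a≤b →
        (λ l c d r → proj₂ (llp⁻ l) c d r (proj₁ (rlp⁻ r))) ,
        (λ lifts → llp⁺ (a≤b , λ c d r _ → lifts c d r))
    ; 𝓡-char = λ c d c≤d →
        (λ r a b l → proj₂ (llp⁻ l) c d r c≤d) ,
        (λ lifts → rlp⁺ (c≤d , λ a b k a≤b →
                     lifts a b (llp⁺ (a≤b , λ _ _ r _ → proj₂ (rlp⁻ r) a b k a≤b))))
    }

  generated : RelSet → WFS
  generated S = cofibrantlyGenerated (llp S)

  module _ (W : WFS) where

    𝓡-⊆-rlp-𝓛 : 𝓡 W ⊆ rlp (𝓛 W)
    𝓡-⊆-rlp-𝓛 c d r =
      rlp⁺ (𝓡-rel W c d r , λ a b l _ → proj₁ (𝓡-char W c d (𝓡-rel W c d r)) r a b l)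

    rlp-𝓛-⊆-𝓡 : rlp (𝓛 W) ⊆ 𝓡 W
    rlp-𝓛-⊆-𝓡 c d r =
      proj₂ (𝓡-char W c d (proj₁ (rlp⁻ r))) (λ a b l → proj₂ (rlp⁻ r) a b l (𝓛-rel W a b l))

    𝓡-isTransferSystem : IsTransferSystem (𝓡 W)
    𝓡-isTransferSystem =
      isTransferSystem-resp rlp-𝓛-⊆-𝓡 𝓡-⊆-rlp-𝓛 (rlp-isTransferSystem (𝓛 W))

  strict-⊆⇒⊆ : ∀ {S} W → IsTransferSystem S → (∀ {a b} → a < b → T (𝓡 W a b) → T (S a b)) → 𝓡 W ⊆ S
  strict-⊆⇒⊆ W ts strict-⊆ a b r with a ≟ b
  ... | yes refl = IsTransferSystem.reflexive ts a
  ... | no a≢b   = strict-⊆ (𝓡-rel W a b r , a≢b) r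

  ⊆-𝓡-generated : ∀ {S} → AreRelations S → S ⊆ 𝓡 (generated S)
  ⊆-𝓡-generated = ⊆-rlp-llp

  𝓡-generated-⊆ : ∀ {S S′} → IsTransferSystem S′ → S ⊆ S′ → 𝓡 (generated S) ⊆ S′
  𝓡-generated-⊆ ts S⊆S′ a b r = TransferSystem.rlp-llp-⊆ ts a b (rlp-antitone (llp-antitone S⊆S′) a b r)

  generated-least : ∀ {S} W → S ⊆ 𝓡 W → generated S ⊑ W
  generated-least W = 𝓡-generated-⊆ (𝓡-isTransferSystem W)

  bottom : WFS
  bottom = generated ∅

  bottom-least : ∀ W → bottom ⊑ W
  bottom-least W = generated-least W λ _ _ ()

  𝓡-bottom : ∀ {a b} → T (𝓡 bottom a b) → a ≡ b
  𝓡-bottom {a} {b} r =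
    let a≤b , lifts = rlp⁻ r in
    ≤-antisym a≤b (lifts a b (llp⁺ (a≤b , λ _ _ ())) a≤b ≤-refl ≤-refl)

  _⋎_ _⋏_ : WFS → WFS → WFS
  W ⋎ W′ = generated (𝓡 W ∪ 𝓡 W′)
  W ⋏ W′ = generated (𝓡 W ∩ 𝓡 W′)

  ⋎-isJoin : ∀ W W′ → IsJoinOf W W′ (W ⋎ W′)
  ⋎-isJoin W W′ =
      (λ a b r → ⊆-𝓡-generated relations a b (Equivalence.from T-∨ (inj₁ r)))
    , (λ a b r → ⊆-𝓡-generated relations a b (Equivalence.from T-∨ (inj₂ r)))
    , λ V W⊑V W′⊑V → generated-least V λ a b t → [ W⊑V a b , W′⊑V a b ] (Equivalence.to T-∨ t)
    where
      relations : AreRelations (𝓡 W ∪ 𝓡 W′)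
      relations a b t = [ 𝓡-rel W a b , 𝓡-rel W′ a b ] (Equivalence.to T-∨ t)

  ⋏-⊇ : ∀ W W′ {a b} → T (𝓡 W a b) → T (𝓡 W′ a b) → T (𝓡 (W ⋏ W′) a b)
  ⋏-⊇ W W′ {a} {b} r r′ =
    ⊆-𝓡-generated (λ a b t → 𝓡-rel W a b (proj₁ (Equivalence.to T-∧ t))) a b
                  (Equivalence.from T-∧ (r , r′))

  ⋏-isMeet : ∀ W W′ → IsMeetOf W W′ (W ⋏ W′)
  ⋏-isMeet W W′ =
      generated-least W (λ a b t → proj₁ (Equivalence.to T-∧ t))
    , generated-least W′ (λ a b t → proj₂ (Equivalence.to T-∧ t))
    , λ V V⊑W V⊑W′ a b r → ⋏-⊇ W W′ (V⊑W a b r) (V⊑W′ a b r)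

  -- Right classes are Boolean m × m matrices, coded as numbers below (2 ^ m) ^ m.
  finite : ∃ λ k → Σ (Fin k → WFS) λ e → ∀ W → ∃ λ i → W ≋ e i
  finite = (2 ^ m) ^ m , generated ∘ decode , λ W → encode (𝓡 W) , W≋generated W
    where
      decode : Fin ((2 ^ m) ^ m) → RelSet
      decode i a b = Inverse.to 2↔Bool (finToFun (finToFun i a) b)

      encode : RelSet → Fin ((2 ^ m) ^ m)
      encode S = funToFin λ a → funToFin λ b → Inverse.from 2↔Bool (S a b)

      decode-encode : ∀ S a b → decode (encode S) a b ≡ S a b
      decode-encode S a b = begin
        Inverse.to 2↔Bool (finToFun (finToFun (encode S) a) b)
          ≡⟨ cong (λ f → Inverse.to 2↔Bool (finToFun f b)) (finToFun-funToFin _ a) ⟩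
        Inverse.to 2↔Bool (finToFun (funToFin λ b → Inverse.from 2↔Bool (S a b)) b)
          ≡⟨ cong (Inverse.to 2↔Bool) (finToFun-funToFin _ b) ⟩
        Inverse.to 2↔Bool (Inverse.from 2↔Bool (S a b))
          ≡⟨ Inverse.strictlyInverseˡ 2↔Bool (S a b) ⟩
        S a b ∎
        where open ≡-Reasoning

      W≋generated : ∀ W → W ≋ generated (decode (encode (𝓡 W)))
      W≋generated W =
          (λ a b r → ⊆-𝓡-generated (λ a b t → 𝓡-rel W a b (subst T (decode-encode (𝓡 W) a b) t)) a b
                                   (subst T (sym (decode-encode (𝓡 W) a b)) r))
        , generated-least W (λ a b t → subst T (decode-encode (𝓡 W) a b) t)

  record StrictPairEnumeration : Set ℓ where
    field
      size            : ℕ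
      pair            : Fin size → Fin m × Fin m
      pair-strict     : ∀ i → IsStrict (pair i)
      pair-injective  : ∀ i j → pair i ≡ pair j → i ≡ j
      pair-surjective : ∀ {p} → IsStrict p → ∃ λ i → pair i ≡ p

    pair-elim : ∀ {ℓ′ a b} (P : Fin m × Fin m → Set ℓ′) → a < b → (∀ i → P (pair i)) → P (a , b)
    pair-elim P a<b P-pair = let i , pairᵢ≡ab = pair-surjective {_ , _} a<b in subst P pairᵢ≡ab (P-pair i)

  module JoinIrreducibles where
    open FiniteJoins _⊑_ (λ {U} {V} {W} → ⊑-trans {U} {V} {W}) _⋎_ ⋎-isJoin bottom bottom-least

    opaque
      single : Fin m → Fin m → RelSet
      single x y = ⟦ (λ a b → (a ≟ x) ×-dec (b ≟ y)) ⟧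

      single⁻ : ∀ {x y a b} → T (single x y a b) → a ≡ x × b ≡ y
      single⁻ = toWitness

      single⁺ : ∀ {x y} → T (single x y x y)
      single⁺ = fromWitness (refl , refl)

    single-relations : ∀ {x y} → x ≤ y → AreRelations (single x y)
    single-relations x≤y a b t with single⁻ t
    ... | refl , refl = x≤y

    single-⊆ : ∀ {x y} S → T (S x y) → single x y ⊆ S
    single-⊆ S s a b t with single⁻ t
    ... | refl , refl = s

    principal : Fin m → Fin m → WFS
    principal x y = generated (single x y)

    principal-∋ : ∀ {x y} → x ≤ y → T (𝓡 (principal x y) x y)
    principal-∋ {x} {y} x≤y = ⊆-𝓡-generated (single-relations x≤y) x y single⁺

    principal-least : ∀ {x y} W → T (𝓡 W x y) → principal x y ⊑ W
    principal-least W r = generated-least W (single-⊆ (𝓡 W) r)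

    Restriction : Fin m → Fin m → Fin m → Fin m → Set ℓ
    Restriction x y a b = a ≡ b ⊎ (b ≤ y × a ≡ x ∧ b)

    restriction-transitive : ∀ {x y a b c} → Restriction x y a b → Restriction x y b c → Restriction x y a c
    restriction-transitive (inj₁ refl) s = s
    restriction-transitive r (inj₁ refl) = r
    restriction-transitive {x} (inj₂ (_ , refl)) (inj₂ (c≤y , refl)) = inj₂ (c≤y , y≤x⇒x∧y≈y (x∧y≤x x _))

    restriction-restrict : ∀ {x y a b} z → Restriction x y a b → z ≤ b → Restriction x y (a ∧ z) z
    restriction-restrict z (inj₁ refl) z≤b = inj₁ (y≤x⇒x∧y≈y z≤b)
    restriction-restrict {x} {b = b} z (inj₂ (b≤y , refl)) z≤b =
      inj₂ (≤-trans z≤b b≤y , trans (∧-assoc x b z) (cong (x ∧_) (y≤x⇒x∧y≈y z≤b)))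

    restriction-relation : ∀ {x y a b} → Restriction x y a b → a ≤ b
    restriction-relation (inj₁ refl)       = ≤-refl
    restriction-relation (inj₂ (_ , refl)) = x∧y≤y _ _

    restriction? : ∀ x y a b → Dec (Restriction x y a b)
    restriction? x y a b = (a ≟ b) ⊎-dec ((b ≤? y) ×-dec (a ≟ x ∧ b))

    opaque
      restrictions : Fin m → Fin m → RelSet
      restrictions x y = ⟦ restriction? x y ⟧

      restrictions⁻ : ∀ {x y a b} → T (restrictions x y a b) → Restriction x y a b
      restrictions⁻ = toWitness

      restrictions⁺ : ∀ {x y a b} → Restriction x y a b → T (restrictions x y a b)
      restrictions⁺ = fromWitness

      restrictions-isTransferSystem : ∀ x y → IsTransferSystem (restrictions x y)
      restrictions-isTransferSystem x y =
        isTransferSystem-⟦ restriction? x y ⟧ restriction-relation (λ _ → inj₁ refl)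
                                              restriction-transitive (λ z → restriction-restrict z)

    𝓡-principal-⊆ : ∀ {x y} → x ≤ y → 𝓡 (principal x y) ⊆ restrictions x y
    𝓡-principal-⊆ {x} {y} x≤y =
      𝓡-generated-⊆ (restrictions-isTransferSystem x y)
                    (single-⊆ (restrictions x y) (restrictions⁺ (inj₂ (≤-refl , sym (x≤y⇒x∧y≡x x≤y)))))

    module _ {x y : Fin m} (x<y : x < y) where
      private
        x≤y : x ≤ y
        x≤y = proj₁ x<y

        x≢y : ¬ x ≡ y
        x≢y = proj₂ x<y

      ProperRestriction : Fin m → Fin m → Set ℓ
      ProperRestriction a b = Restriction x y a b × ¬ (a ≡ x × b ≡ y)

      proper-transitive : ∀ {a b c} → ProperRestriction a b → ProperRestriction b c → ProperRestriction a c
      proper-transitive (inj₁ refl , _) s = s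
      proper-transitive r (inj₁ refl , _) = r
      proper-transitive (r@(inj₂ _) , _) (s@(inj₂ (_ , refl)) , bc≢xy) =
        restriction-transitive r s ,
        λ (_ , c≡y) → bc≢xy (trans (cong (x ∧_) c≡y) (x≤y⇒x∧y≡x x≤y) , c≡y)

      proper-restrict : ∀ {a b} z → ProperRestriction a b → z ≤ b → ProperRestriction (a ∧ z) z
      proper-restrict z (r , ab≢xy) z≤b = restriction-restrict z r z≤b , ≢xy r
        where
          ≢xy : Restriction x y _ _ → ¬ (_ ∧ z ≡ x × z ≡ y)
          ≢xy (inj₁ refl) (a∧z≡x , z≡y) = x≢y (trans (sym a∧z≡x) (trans (y≤x⇒x∧y≈y z≤b) z≡y))
          ≢xy (inj₂ (b≤y , refl)) (_ , refl) with ≤-antisym b≤y z≤b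
          ... | refl = ab≢xy (x≤y⇒x∧y≡x x≤y , refl)

      properRestriction? : ∀ a b → Dec (ProperRestriction a b)
      properRestriction? a b = restriction? x y a b ×-dec ¬? ((a ≟ x) ×-dec (b ≟ y))

      opaque
        properRestrictions : RelSet
        properRestrictions = ⟦ properRestriction? ⟧

        properRestrictions-isTransferSystem : IsTransferSystem properRestrictions
        properRestrictions-isTransferSystem =
          isTransferSystem-⟦ properRestriction? ⟧ (restriction-relation ∘ proj₁)
            (λ a → inj₁ refl , λ (a≡x , a≡y) → x≢y (trans (sym a≡x) a≡y)) proper-transitive proper-restrict

        properRestrictions⁻ : ∀ {a b} → T (properRestrictions a b) → ProperRestriction a b
        properRestrictions⁻ = toWitness

        properRestrictions⁺ : ∀ {a b} → ProperRestriction a b → T (properRestrictions a b)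
        properRestrictions⁺ = fromWitness

      principal-joinIrreducible : JoinIrreducible (principal x y)
      principal-joinIrreducible = notBottom , irreducible
        where
          notBottom : ¬ (∀ W → principal x y ⊑ W)
          notBottom below = x≢y (𝓡-bottom (below bottom x y (principal-∋ x≤y)))

          V : WFS
          V = generated properRestrictions

          ⊑V : ∀ W → W ⊑ principal x y → ¬ T (𝓡 W x y) → W ⊑ V
          ⊑V W W⊑ ¬r a b r =
            ⊆-𝓡-generated (IsTransferSystem.relations properRestrictions-isTransferSystem) a b
              (properRestrictions⁺ ( restrictions⁻ (𝓡-principal-⊆ x≤y a b (W⊑ a b r))
                                   , λ { (refl , refl) → ¬r r }))

          irreducible : ∀ A B → IsJoinOf A B (principal x y) → principal x y ≋ A ⊎ principal x y ≋ B
          irreducible A B (A⊑ , B⊑ , least) with T? (𝓡 A x y) | T? (𝓡 B x y)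
          ... | yes r | _     = inj₁ (principal-least A r , A⊑)
          ... | no _  | yes r = inj₂ (principal-least B r , B⊑)
          ... | no ¬r | no ¬s =
            let xy∈V = least V (⊑V A A⊑ ¬r) (⊑V B B⊑ ¬s) x y (principal-∋ x≤y) in
            contradiction (refl , refl)
              (proj₂ (properRestrictions⁻
                (𝓡-generated-⊆ properRestrictions-isTransferSystem (λ _ _ p → p) x y xy∈V)))

    principal-injective : ∀ {x y x′ y′} → x < y → x′ < y′ → principal x y ≋ principal x′ y′ → x ≡ x′ × y ≡ y′
    principal-injective {x} {y} {x′} {y′} (x≤y , x≢y) (x′≤y′ , x′≢y′) (⊑′ , ⊒′)
      with restrictions⁻ (𝓡-principal-⊆ x≤y x′ y′ (⊒′ x′ y′ (principal-∋ x′≤y′)))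
         | restrictions⁻ (𝓡-principal-⊆ x′≤y′ x y (⊑′ x y (principal-∋ x≤y)))
    ... | inj₁ x′≡y′ | _          = contradiction x′≡y′ x′≢y′
    ... | _          | inj₁ x≡y   = contradiction x≡y x≢y
    ... | inj₂ (y′≤y , x′≡x∧y′) | inj₂ (y≤y′ , _) with ≤-antisym y′≤y y≤y′
    ...   | refl = sym (trans x′≡x∧y′ (x≤y⇒x∧y≡x x≤y)) , refl

    module _ (E : StrictPairEnumeration) where
      open StrictPairEnumeration E

      principalAt : Fin size → WFS
      principalAt i = principal (proj₁ (pair i)) (proj₂ (pair i))

      support : WFS → List (Fin size)
      support W = filter (λ i → T? (𝓡 W (proj₁ (pair i)) (proj₂ (pair i)))) (allFin size)

      W≋⋁principalAt : ∀ W → W ≋ ⋁ principalAt (support W)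
      W≋⋁principalAt W =
          W⊑⋁
        , ⋁-least principalAt (support W) {W} λ i i∈ →
            principal-least W (proj₂ (∈-filter⁻ inW? {xs = allFin size} i∈))
        where
          inW? : ∀ i → Dec (T (𝓡 W (proj₁ (pair i)) (proj₂ (pair i))))
          inW? i = T? (𝓡 W (proj₁ (pair i)) (proj₂ (pair i)))

          W⊑⋁ : W ⊑ ⋁ principalAt (support W)
          W⊑⋁ = strict-⊆⇒⊆ W (𝓡-isTransferSystem (⋁ principalAt (support W))) λ {a} {b} a<b →
            pair-elim (λ (a , b) → T (𝓡 W a b) → T (𝓡 (⋁ principalAt (support W)) a b)) a<b
              λ i r → ⊑-⋁ principalAt (∈-filter⁺ inW? (∈-allFin i) r) _ _
                            (principal-∋ (proj₁ (pair-strict i)))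

      exactlyJoinIrreducibles : ExactlyN size JoinIrreducible
      exactlyJoinIrreducibles =
          principalAt
        , (λ i j principalᵢ≋principalⱼ →
             let x≡x′ , y≡y′ = principal-injective (pair-strict i) (pair-strict j) principalᵢ≋principalⱼ in
             pair-injective i j (cong₂ _,_ x≡x′ y≡y′))
        , (λ i → principal-joinIrreducible (pair-strict i))
        , λ W ji → joinIrreducible-⋁ principalAt (support W) {W} ji (W≋⋁principalAt W)

  module Chain where

    ↓_ : Fin m → Subset.Subset m
    ↓ a = tabulate λ c → isYes (c ≤? a)

    ∈↓⁻ : ∀ {a c} → c Subset.∈ ↓ a → c ≤ a
    ∈↓⁻ {a} {c} c∈↓a =
      toWitness (Equivalence.from T-≡ (trans (sym (lookup∘tabulate _ c)) ([]=⇒lookup c∈↓a)))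

    ∈↓⁺ : ∀ {a c} → c ≤ a → c Subset.∈ ↓ a
    ∈↓⁺ {a} {c} c≤a = lookup⇒[]= c (↓ a) (trans (lookup∘tabulate _ c) (Equivalence.to T-≡ (fromWitness c≤a)))

    κ : Fin m → ℕ
    κ a = Subset.∣ ↓ a ∣

    κ-< : ∀ {a b} → a < b → κ a ℕ.< κ b
    κ-< {a} {b} (a≤b , a≢b) = p⊂q⇒∣p∣<∣q∣
      ( (λ c∈↓a → ∈↓⁺ (≤-trans (∈↓⁻ c∈↓a) a≤b))
      , b , ∈↓⁺ ≤-refl , λ b∈↓a → a≢b (≤-antisym a≤b (∈↓⁻ b∈↓a)))

    _≺_ : Fin m × Fin m → Fin m × Fin m → Set ℓ
    (a′ , b′) ≺ (a , b) = a′ < a ⊎ (a′ ≡ a × b′ < b)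

    -- κ is strictly monotone, so sorting by key lexicographically extends ≺.
    key : Fin m × Fin m → ℕ × ℕ
    key (a , b) = κ a , κ b

    pairOrder : DecTotalOrder _ _ _
    pairOrder = On.decTotalOrder (×-decTotalOrder ℕ.≤-decTotalOrder ℕ.≤-decTotalOrder) key

    open DecTotalOrder pairOrder using () renaming (_≤_ to _⊴_)

    ≺⇒⋬ : ∀ {p q} → q ≺ p → ¬ p ⊴ q
    ≺⇒⋬ (inj₁ a′<a)          (inj₁ (κa≤κa′ , _)) = ℕ.<⇒≱ (κ-< a′<a) κa≤κa′
    ≺⇒⋬ (inj₁ a′<a)          (inj₂ (κa≡κa′ , _)) = ℕ.<⇒≢ (κ-< a′<a) (sym κa≡κa′)
    ≺⇒⋬ (inj₂ (refl , _))    (inj₁ (_ , κa≢κa))  = κa≢κa refl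
    ≺⇒⋬ (inj₂ (refl , b′<b)) (inj₂ (_ , κb≤κb′)) = ℕ.<⇒≱ (κ-< b′<b) κb≤κb′

    open Sort pairOrder using (sort; sort-↭; sort-↗)

    private
      allPairs strictPairs : List (Fin m × Fin m)
      allPairs    = cartesianProduct (allFin m) (allFin m)
      strictPairs = filter isStrict? allPairs

    linearExtension : List (Fin m × Fin m)
    linearExtension = sort strictPairs

    private
      n : ℕ
      n = length linearExtension

      pair : Fin n → Fin m × Fin m
      pair = lookup linearExtension

    enumeration : StrictPairEnumeration
    enumeration = record
      { size            = n
      ; pair            = pair
      ; pair-strict     = λ i → proj₂ (∈-filter⁻ isStrict? {xs = allPairs}
                                         (∈-resp-↭ (sort-↭ strictPairs) (∈-lookup i)))
      ; pair-injective  = lookup-injective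
          (Permutationₛ.Unique-resp-↭ (setoid _) (↭⇒↭ₛ (↭-sym (sort-↭ strictPairs)))
            (Unique.filter⁺ isStrict? (Unique.cartesianProduct⁺ (Unique.allFin⁺ m) (Unique.allFin⁺ m))))
      ; pair-surjective = λ {(a , b)} a<b →
          let ab∈ = ∈-resp-↭ (↭-sym (sort-↭ strictPairs))
                      (∈-filter⁺ isStrict? (∈-cartesianProduct⁺ (∈-allFin a) (∈-allFin b)) a<b)
          in index ab∈ , sym (lookup-index ab∈)
      }

    open StrictPairEnumeration enumeration using (pair-strict; pair-injective; pair-surjective; pair-elim)

    pair-≺ : ∀ {q} i → q ≺ pair i → IsStrict q → ∃ λ j → toℕ j ℕ.< toℕ i × pair j ≡ q
    pair-≺ {q} i q≺pairᵢ q-strict with pair-surjective q-strict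
    ... | j , pairⱼ≡q =
      j , ℕ.≰⇒> (λ i≤j → ≺⇒⋬ q≺pairᵢ (subst (pair i ⊴_) pairⱼ≡q
                                          (Sorted.lookup-mono-≤ (DecTotalOrder.totalOrder pairOrder)
                                                                (sort-↗ strictPairs) i≤j)))
        , pairⱼ≡q

    module ≺-Closed {p} (R : Fin m → Fin m → Set p)
      (relation : ∀ {a b} → R a b → a ≤ b) (reflexive : ∀ a → R a a)
      (closed : ∀ {a b q} → a < b → R a b → q ≺ (a , b) → IsStrict q → R (proj₁ q) (proj₂ q))
      where

      down : ∀ {a b u} → a < b → R a b → u < a → R u b
      down {a} {b} {u} a<b@(a≤b , _) r (u≤a , u≢a) =
        closed a<b r (inj₁ (u≤a , u≢a)) (≤-trans u≤a a≤b , u≢b)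
        where
          u≢b : ¬ u ≡ b
          u≢b refl = u≢a (≤-antisym u≤a a≤b)

      transitive : ∀ {a b c} → R a b → R b c → R a c
      transitive {a} {b} {c} r s with a ≟ b | b ≟ c
      ... | yes refl | _        = s
      ... | no _     | yes refl = r
      ... | no a≢b   | no b≢c   = down (relation s , b≢c) s (relation r , a≢b)

      restrict : ∀ {a b} z → R a b → z ≤ b → R (a ∧ z) z
      restrict {a} {b} z r z≤b with (a ∧ z) ≟ z
      ... | yes a∧z≡z = subst (λ u → R u z) (sym a∧z≡z) (reflexive z)
      ... | no a∧z≢z with a ≟ b
      ...   | yes refl = contradiction (y≤x⇒x∧y≈y z≤b) a∧z≢z
      ...   | no a≢b with (a ∧ z) ≟ a
      ...     | no a∧z≢a  = closed (relation r , a≢b) r (inj₁ (x∧y≤x a z , a∧z≢a)) (x∧y≤y a z , a∧z≢z)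
      ...     | yes a∧z≡a with z ≟ b
      ...       | yes refl = subst (λ u → R u z) (sym a∧z≡a) r
      ...       | no z≢b   = closed (relation r , a≢b) r (inj₂ (a∧z≡a , z≤b , z≢b)) (x∧y≤y a z , a∧z≢z)

    Initial : ℕ → Fin m → Fin m → Set
    Initial k a b = a ≡ b ⊎ ∃ λ i → toℕ i ℕ.< k × pair i ≡ (a , b)

    initial? : ∀ k a b → Dec (Initial k a b)
    initial? k a b = (a ≟ b) ⊎-dec any? λ i → (toℕ i ℕ.<? k) ×-dec ≡-dec _≟_ _≟_ (pair i) (a , b)

    initial-relation : ∀ {k a b} → Initial k a b → a ≤ b
    initial-relation (inj₁ refl)              = ≤-refl
    initial-relation (inj₂ (i , _ , pairᵢ≡ab)) = proj₁ (subst IsStrict pairᵢ≡ab (pair-strict i))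

    initial-closed : ∀ {k a b q} → a < b → Initial k a b → q ≺ (a , b) → IsStrict q → Initial k (proj₁ q) (proj₂ q)
    initial-closed (_ , a≢b) (inj₁ a≡b) _ _ = contradiction a≡b a≢b
    initial-closed {q = q} _ (inj₂ (i , i<k , pairᵢ≡ab)) q≺ab q-strict =
      let j , j<i , pairⱼ≡q = pair-≺ i (subst (q ≺_) (sym pairᵢ≡ab) q≺ab) q-strict in
      inj₂ (j , ℕ.<-trans j<i i<k , pairⱼ≡q)

    module InitialSegment (k : ℕ) = ≺-Closed (Initial k) initial-relation (λ _ → inj₁ refl) initial-closed

    initial-mono : ∀ {k l a b} → k ℕ.≤ l → Initial k a b → Initial l a b
    initial-mono _   (inj₁ a≡b)              = inj₁ a≡b
    initial-mono k≤l (inj₂ (i , i<k , pairᵢ≡ab)) = inj₂ (i , ℕ.<-≤-trans i<k k≤l , pairᵢ≡ab)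

    initial-zero : ∀ {a b} → Initial 0 a b → a ≡ b
    initial-zero (inj₁ a≡b) = a≡b

    initial-suc : ∀ {k a b} i → toℕ i ≡ k → Initial (suc k) a b → Initial k a b ⊎ pair i ≡ (a , b)
    initial-suc i _ (inj₁ a≡b) = inj₁ (inj₁ a≡b)
    initial-suc {k} i toℕi≡k (inj₂ (j , j<1+k , pairⱼ≡ab)) with toℕ j ℕ.<? k
    ... | yes j<k = inj₁ (inj₂ (j , j<k , pairⱼ≡ab))
    ... | no j≮k  = inj₂ (subst (λ j → pair j ≡ _)
                           (toℕ-injective (trans (ℕ.≤-antisym (ℕ.≤-pred j<1+k) (ℕ.≮⇒≥ j≮k)) (sym toℕi≡k)))
                           pairⱼ≡ab)

    initial-pair : ∀ {k} i → toℕ i ℕ.< k → Initial k (proj₁ (pair i)) (proj₂ (pair i))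
    initial-pair i i<k = inj₂ (i , i<k , refl)

    ¬initial-pair : ∀ {k} i → k ℕ.≤ toℕ i → ¬ Initial k (proj₁ (pair i)) (proj₂ (pair i))
    ¬initial-pair i _ (inj₁ a≡b) = proj₂ (pair-strict i) a≡b
    ¬initial-pair i k≤i (inj₂ (j , j<k , pairⱼ≡pairᵢ)) with pair-injective j i pairⱼ≡pairᵢ
    ... | refl = ℕ.<-irrefl refl (ℕ.<-≤-trans j<k k≤i)

    opaque
      chainSet : ℕ → RelSet
      chainSet k = ⟦ initial? k ⟧

      chainSet-isTransferSystem : ∀ k → IsTransferSystem (chainSet k)
      chainSet-isTransferSystem k =
        isTransferSystem-⟦ initial? k ⟧ initial-relation (λ _ → inj₁ refl)
                                        (InitialSegment.transitive k) (InitialSegment.restrict k)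

      chainSet⁻ : ∀ {k a b} → T (chainSet k a b) → Initial k a b
      chainSet⁻ = toWitness

      chainSet⁺ : ∀ {k a b} → Initial k a b → T (chainSet k a b)
      chainSet⁺ = fromWitness

    chain : ℕ → WFS
    chain k = generated (chainSet k)

    𝓡-chain⁻ : ∀ {k a b} → T (𝓡 (chain k) a b) → Initial k a b
    𝓡-chain⁻ {k} {a} {b} r = chainSet⁻ (𝓡-generated-⊆ (chainSet-isTransferSystem k) (λ _ _ s → s) a b r)

    𝓡-chain⁺ : ∀ {k a b} → Initial k a b → T (𝓡 (chain k) a b)
    𝓡-chain⁺ {k} {a} {b} ι =
      ⊆-𝓡-generated (IsTransferSystem.relations (chainSet-isTransferSystem k)) a b (chainSet⁺ ι)

    chain-mono : ∀ {k l} → k ℕ.≤ l → chain k ⊑ chain l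
    chain-mono k≤l a b r = 𝓡-chain⁺ (initial-mono k≤l (𝓡-chain⁻ r))

    chain-zero-least : ∀ W → chain 0 ⊑ W
    chain-zero-least W a b r with initial-zero (𝓡-chain⁻ r)
    ... | refl = IsTransferSystem.reflexive (𝓡-isTransferSystem W) a

    ⊑-chain-size : ∀ W → W ⊑ chain n
    ⊑-chain-size W = strict-⊆⇒⊆ W (𝓡-isTransferSystem (chain n)) λ a<b _ →
      pair-elim (λ (a , b) → T (𝓡 (chain n) a b)) a<b λ i → 𝓡-chain⁺ (initial-pair i (toℕ<n i))

    chain-⊏ : ∀ {k l} → k ℕ.< l → l ℕ.≤ n → chain k ⊏ chain l
    chain-⊏ {k} {l} k<l l≤n = chain-mono (ℕ.<⇒≤ k<l) , λ l⊑k →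
      ¬initial-pair i (ℕ.≤-reflexive (sym toℕi≡k))
        (𝓡-chain⁻ (l⊑k _ _ (𝓡-chain⁺ (initial-pair i (ℕ.≤-<-trans (ℕ.≤-reflexive toℕi≡k) k<l)))))
      where
        k<n : k ℕ.< n
        k<n = ℕ.<-≤-trans k<l l≤n

        i : Fin n
        i = fromℕ< k<n

        toℕi≡k : toℕ i ≡ k
        toℕi≡k = toℕ-fromℕ< k<n

    covering : ∀ {W k} i → toℕ i ≡ k → chain k ⊑ W → W ⊑ chain (suc k) → W ≋ chain k ⊎ W ≋ chain (suc k)
    covering {W} i toℕi≡k k⊑W W⊑1+k = decide (T? (𝓡 W (proj₁ (pair i)) (proj₂ (pair i))))
      where
        decide : Dec (T (𝓡 W (proj₁ (pair i)) (proj₂ (pair i)))) → W ≋ chain _ ⊎ W ≋ chain (suc _)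
        decide (yes pairᵢ∈W) = inj₂ (W⊑1+k , λ a b r →
          [ (λ ι → k⊑W a b (𝓡-chain⁺ ι))
          , (λ pairᵢ≡ab → subst (λ (a , b) → T (𝓡 W a b)) pairᵢ≡ab pairᵢ∈W) ]
            (initial-suc i toℕi≡k (𝓡-chain⁻ r)))
        decide (no pairᵢ∉W) = inj₁ ((λ a b r →
          [ 𝓡-chain⁺
          , (λ pairᵢ≡ab → contradiction (subst (λ (a , b) → T (𝓡 W a b)) (sym pairᵢ≡ab) r) pairᵢ∉W) ]
            (initial-suc i toℕi≡k (𝓡-chain⁻ (W⊑1+k a b r))))
          , k⊑W)

    comparable-with-chain⇒≋ : ∀ {W} → (∀ k → k ℕ.≤ n → W ⊑ chain k ⊎ chain k ⊑ W) →
                              ∀ k → k ℕ.≤ n → W ⊑ chain k → ∃ λ l → l ℕ.≤ n × W ≋ chain l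
    comparable-with-chain⇒≋ {W} _ zero _ W⊑0 = 0 , ℕ.z≤n , W⊑0 , chain-zero-least W
    comparable-with-chain⇒≋ {W} comparable (suc k) 1+k≤n W⊑1+k =
      [ comparable-with-chain⇒≋ {W} comparable k k≤n
      , (λ k⊑W → [ (λ W≋k → k , k≤n , W≋k) , (λ W≋1+k → suc k , 1+k≤n , W≋1+k) ]
                   (covering {W} (fromℕ< 1+k≤n) (toℕ-fromℕ< 1+k≤n) k⊑W W⊑1+k))
      ] (comparable k k≤n)
      where
        k≤n : k ℕ.≤ n
        k≤n = ℕ.<⇒≤ 1+k≤n

    module _ (y : WFS) (k : ℕ) where
      private
        module Y = IsTransferSystem (𝓡-isTransferSystem y)

      Through : Fin m → Fin m → Set
      Through a b = ∃ λ u → Initial k a u × T (𝓡 y u b)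

      through? : ∀ a b → Dec (Through a b)
      through? a b = any? λ u → initial? k a u ×-dec T? (𝓡 y u b)

      through-relation : ∀ {a b} → Through a b → a ≤ b
      through-relation {b = b} (u , a↝u , u↝b) = ≤-trans (initial-relation a↝u) (𝓡-rel y u b u↝b)

      through-transitive : ∀ {a b c} → Through a b → Through b c → Through a c
      through-transitive {a} {b} {c} (u , a↝u , u↝b) (v , b↝v , v↝c) with b ≟ v | u ≟ b
      ... | yes refl | _        = u , a↝u , Y.transitive u↝b v↝c
      ... | no _     | yes refl = v , InitialSegment.transitive k a↝u b↝v , v↝c
      ... | no b≢v   | no u≢b   =
        v , InitialSegment.transitive k a↝u
              (InitialSegment.down k (initial-relation b↝v , b≢v) b↝v (𝓡-rel y u b u↝b , u≢b))
          , v↝c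

      through-restrict : ∀ {a b} z → Through a b → z ≤ b → Through (a ∧ z) z
      through-restrict {a} z (u , a↝u , u↝b) z≤b =
        u ∧ z , subst (λ w → Initial k w (u ∧ z)) a∧[u∧z]≡a∧z
                      (InitialSegment.restrict k (u ∧ z) a↝u (x∧y≤x u z))
              , Y.restrict z u↝b z≤b
        where
          a∧[u∧z]≡a∧z : a ∧ (u ∧ z) ≡ a ∧ z
          a∧[u∧z]≡a∧z = trans (sym (∧-assoc a u z)) (cong (_∧ z) (x≤y⇒x∧y≡x (initial-relation a↝u)))

      opaque
        through : RelSet
        through = ⟦ through? ⟧

        through-isTransferSystem : IsTransferSystem through
        through-isTransferSystem =
          isTransferSystem-⟦ through? ⟧ through-relation (λ a → a , inj₁ refl , Y.reflexive a)
                                        through-transitive through-restrict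

        through⁻ : ∀ {a b} → T (through a b) → Through a b
        through⁻ = toWitness

        through⁺ : ∀ {a b} → Through a b → T (through a b)
        through⁺ = fromWitness

      𝓡-⋎chain-⊆-through : 𝓡 (y ⋎ chain k) ⊆ through
      𝓡-⋎chain-⊆-through = 𝓡-generated-⊆ through-isTransferSystem λ a b t →
        [ (λ a↝b → through⁺ (a , inj₁ refl , a↝b)) , (λ a↝b → through⁺ (b , 𝓡-chain⁻ a↝b , Y.reflexive b)) ]
          (Equivalence.to T-∨ t)

    chain-leftModular : ∀ k → LeftModular _⋎_ _⋏_ (chain k)
    chain-leftModular k y z (y⊑z , _) =
        ⊑-modular
      , modular-inequality _⊑_ (λ {U} {V} {W} → ⊑-trans {U} {V} {W}) _⋎_ _⋏_ ⋎-isJoin ⋏-isMeet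
                           {X} {y} {z} y⊑z
      where
        X : WFS
        X = chain k

        ⊑-modular : ((y ⋎ X) ⋏ z) ⊑ (y ⋎ (X ⋏ z))
        ⊑-modular a b r =
          let a↝b∈y⋎X = proj₁ (⋏-isMeet (y ⋎ X) z) a b r
              a↝b∈z   = proj₁ (proj₂ (⋏-isMeet (y ⋎ X) z)) a b r
              u , a↝u , u↝b = through⁻ y k (𝓡-⋎chain-⊆-through y k a b a↝b∈y⋎X)
              a≤u = initial-relation a↝u
              a↝u∈z = subst (λ w → T (𝓡 z w u)) (x≤y⇒x∧y≡x a≤u)
                        (IsTransferSystem.restrict (𝓡-isTransferSystem z) u a↝b∈z (𝓡-rel y u b u↝b))
              y⊑J , X⋏z⊑J , _ = ⋎-isJoin y (X ⋏ z)
          in IsTransferSystem.transitive (𝓡-isTransferSystem (y ⋎ (X ⋏ z)))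
               (X⋏z⊑J a u (⋏-⊇ X z (𝓡-chain⁺ a↝u) a↝u∈z)) (y⊑J u b u↝b)

    chain-maximal : ∀ W → (∀ (i : Fin (suc n)) → W ⊑ chain (toℕ i) ⊎ chain (toℕ i) ⊑ W) →
                    ∃ λ (i : Fin (suc n)) → W ≋ chain (toℕ i)
    chain-maximal W comparable =
      let l , l≤n , W≋l = comparable-with-chain⇒≋ {W} comparableℕ n ℕ.≤-refl (⊑-chain-size W) in
      fromℕ< (ℕ.s≤s l≤n) , subst (λ l → W ≋ chain l) (sym (toℕ-fromℕ< (ℕ.s≤s l≤n))) W≋l
      where
        comparableℕ : ∀ k → k ℕ.≤ n → W ⊑ chain k ⊎ chain k ⊑ W
        comparableℕ k k≤n =
          subst (λ k → W ⊑ chain k ⊎ chain k ⊑ W) (toℕ-fromℕ< (ℕ.s≤s k≤n)) (comparable (fromℕ< (ℕ.s≤s k≤n)))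

module MeetIrreducibles {ℓ : Level} (m : ℕ) (_≤_ : Rel (Fin m) ℓ) (_∨_ _∧_ : Op₂ (Fin m))
                        (isLattice : IsLattice _≡_ _≤_ _∨_ _∧_) where

  open WeakFactorizationSystems m _≤_ _∨_ _∧_ isLattice
  private
    module Op = WeakFactorizationSystems m (flip _≤_) _∧_ _∨_ isLatticeᵒᵖ
  open Duality m _≤_ using (dual; dual-antitone)
  open Duality m (flip _≤_) using () renaming (dual to dualᵒᵖ; dual-antitone to dualᵒᵖ-antitone)

  reverse : StrictPairEnumeration → Op.StrictPairEnumeration
  reverse E = record
    { size            = size
    ; pair            = swap ∘ pair
    ; pair-strict     = λ i → let a≤b , a≢b = pair-strict i in a≤b , a≢b ∘ sym
    ; pair-injective  = λ i j swapped≡ → pair-injective i j (cong swap swapped≡)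
    ; pair-surjective = λ {p} (b≤a , a≢b) →
        let i , pairᵢ≡swap-p = pair-surjective {swap p} (b≤a , a≢b ∘ sym) in i , cong swap pairᵢ≡swap-p
    }
    where open StrictPairEnumeration E

  open AntitoneEquivalence _⊑_ Op._⊑_ (λ {U} {V} {W} → ⊑-trans {U} {V} {W})
         (λ {U} {V} {W} → Op.⊑-trans {U} {V} {W}) dual dualᵒᵖ
         (λ {U} {V} → dual-antitone {U} {V}) (λ {U} {V} → dualᵒᵖ-antitone {U} {V})
         ⊑-refl ⊑-refl Op.⊑-refl Op.⊑-refl

  exactlyMeetIrreducibles : ∀ E → ExactlyN (StrictPairEnumeration.size E) MeetIrreducible
  exactlyMeetIrreducibles E =
    exactlyN-meetIrreducible (Op.JoinIrreducibles.exactlyJoinIrreducibles (reverse E))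

mainTheorem9 : {ℓ : Level} (m : ℕ) (_≤_ : Rel (Fin m) ℓ) (_∨_ _∧_ : Op₂ (Fin m)) →
    IsLattice _≡_ _≤_ _∨_ _∧_ →
    OrderNotions.IsTrim (WFSNotions._⊑_ m _≤_)
mainTheorem9 m _≤_ _∨_ _∧_ isLattice = record
  { ⊑-refl            = ⊑-refl
  ; ⊑-trans           = λ U V W → ⊑-trans {U} {V} {W}
  ; finite            = finite
  ; _∨_               = _⋎_
  ; _∧_               = _⋏_
  ; isJoin            = ⋎-isJoin
  ; isMeet            = ⋏-isMeet
  ; n                 = size
  ; chain             = chain ∘ toℕ
  ; chain-strict      = λ i j i<j → chain-⊏ i<j (ℕ.≤-pred (toℕ<n j))
  ; chain-maximal     = chain-maximal
  ; chain-leftModular = chain-leftModular ∘ toℕ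
  ; joinIrreducibles  = exactlyJoinIrreducibles enumeration
  ; meetIrreducibles  = exactlyMeetIrreducibles enumeration
  }
  where
    open WeakFactorizationSystems m _≤_ _∨_ _∧_ isLattice
    open JoinIrreducibles
    open Chain
    open StrictPairEnumeration enumeration using (size)
    open MeetIrreducibles m _≤_ _∨_ _∧_ isLattice
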